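{- Let $\mathcal{Q}=(Q,\rho)$ be a quasimetric space and let $x,y\in Q$ be distinct with $\overrightarrow{xy}\neq\overrightarrow{yx}$. If $Q\neq \overrightarrow{xy}\cup\overrightarrow{yx}$, then $\mathcal{Q}$ has a universal line or $\lvert\mathcal{L}_\mathcal{Q}\rvert\geq 5$.
   Context: A quasimetric space is a pair $(Q,\rho)$ where $Q$ is a set and $\rho:Q\times Q\to[0,\infty)$ satisfies $\rho(x,y)=0\iff x=y$ and $\rho(x,y)\le \rho(x,z)+\rho(z,y)$ for all $x,y,z\in Q$ ($\rho$ need not be symmetric). For $x,y\in Q$ let $[xy]=\{z\in Q:\rho(x,y)=\rho(x,z)+\rho(z,y)\}$. For distinct $x,y\in Q$, the line $\overrightarrow{xy}=\{z\in Q: x\in[zy]\ \text{or}\ z\in[xy]\ \text{or}\ y\in[xz]\}$. $\mathcal{L}_\mathcal{Q}$ denotes the set of all lines $\overrightarrow{xy}$ with $x\neq y$ in $Q$. A line is universal if it equals $Q$. -}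

module Defs where

open import Level using (0ℓ)
open import Data.Product using (Σ; ∃; ∃-syntax; _×_; _,_)
open import Data.Sum using (_⊎_)
open import Data.Fin using (Fin)
open import Relation.Nullary using (¬_)
open import Relation.Binary.PropositionalEquality using (_≡_; _≢_)
open import Relation.Binary.Structures using (IsTotalOrder)
open import Algebra.Structures using (IsCommutativeRing)

-- An axiomatisation of the real numbers: a Dedekind-complete ordered field
-- (any model of it is isomorphic to ℝ).  Equality is propositional equality.
record RealNumbers : Set₁ where
  infixl 6 _+_
  infixl 7 _*_
  infix 4 _≤_
  field
    ℝ   : Set
    _+_ : ℝ → ℝ → ℝ
    _*_ : ℝ → ℝ → ℝ
    -_  : ℝ → ℝ
    0#  : ℝ
    1#  : ℝ
    _≤_ : ℝ → ℝ → Set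
    isCommutativeRing : IsCommutativeRing _≡_ _+_ _*_ -_ 0# 1#
    0≢1 : 0# ≢ 1#
    inverse : ∀ x → x ≢ 0# → ∃[ y ] (x * y ≡ 1#)
    isTotalOrder : IsTotalOrder _≡_ _≤_
    +-monoˡ-≤ : ∀ {x y} z → x ≤ y → x + z ≤ y + z
    *-nonneg : ∀ {x y} → 0# ≤ x → 0# ≤ y → 0# ≤ x * y
    supremum : (P : ℝ → Set) → ∃[ x ] P x → ∃[ b ] (∀ x → P x → x ≤ b) →
               ∃[ s ] ((∀ x → P x → x ≤ s) ×
                       (∀ b → (∀ x → P x → x ≤ b) → s ≤ b))

record Quasimetric (R : RealNumbers) : Set₁ where
  open RealNumbers R
  field
    Q : Set
    ρ : Q → Q → ℝ
    ρ-nonneg : ∀ x y → 0# ≤ ρ x y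
    ρ-zero⇒eq : ∀ x y → ρ x y ≡ 0# → x ≡ y
    eq⇒ρ-zero : ∀ x → ρ x x ≡ 0#
    triangle : ∀ x y z → ρ x y ≤ ρ x z + ρ z y

module _ {R : RealNumbers} (𝒬 : Quasimetric R) where
  open RealNumbers R
  open Quasimetric 𝒬

  Between : Q → Q → Q → Set
  Between a b z = ρ a b ≡ ρ a z + ρ z b

  Line : Q → Q → Q → Set
  Line x y z = Between z y x ⊎ Between x y z ⊎ Between x z y

  SameSet : (Q → Set) → (Q → Set) → Set
  SameSet A B = ∀ z → (A z → B z) × (B z → A z)

  HasUniversalLine : Set
  HasUniversalLine = ∃[ a ] ∃[ b ] (a ≢ b × (∀ z → Line a b z))

  AtLeastFiveLines : Set
  AtLeastFiveLines =
    Σ (Fin 5 → Q) λ a → Σ (Fin 5 → Q) λ b →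
      (∀ i → a i ≢ b i) ×
      (∀ i j → i ≢ j → ¬ SameSet (Line (a i) (b i)) (Line (a j) (b j)))

-- classical logic (the paper's ambient metatheory)
ExcludedMiddle : Set₁
ExcludedMiddle = (P : Set) → P ⊎ ¬ P

module Submission where

-- Pick z off both lines xy and yx.  Then no ordering of x, y, z is metric, so the lines xy, yx,
-- xz, yz are pairwise distinct and each contains exactly two of x, y, z; a line through all
-- three points, or missing two of them, is a fifth one.  If xz ≠ zx or yz ≠ zy we are done.
-- Otherwise take w on exactly one of xy and yx, say w ∈ xy ∖ yx, and examine the lines joining
-- w to x, y, z.  The quasimetric input is antisymmetry of betweenness: b ∈ [a c] and a ∈ [b c]
-- force a = b, since then ρ(a,b) + ρ(b,a) = 0.

open import Defs
open import Level using (0ℓ)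
open import Function using (_∘_)
open import Algebra.Bundles using (Group)
open import Algebra.Structures using (IsCommutativeRing)
import Algebra.Properties.Group as GroupProperties
open import Relation.Binary.Core using (Rel)
open import Relation.Binary.Definitions using (Symmetric)
open import Relation.Binary.Structures using (IsTotalOrder)
open import Data.Empty using (⊥-elim)
open import Data.Sum using (_⊎_; inj₁; inj₂)
open import Data.Product using (∃; _×_; _,_; proj₁; proj₂; uncurry)
open import Data.Fin using (zero; suc)
open import Data.Vec using (Vec; []; _∷_; lookup)
open import Data.Vec.Relation.Unary.All using (All; []; _∷_)
open import Data.Vec.Relation.Unary.All.Properties using (lookup⁺)
open import Data.Vec.Relation.Unary.AllPairs using (AllPairs; []; _∷_)
open import Relation.Nullary using (¬_)
open import Relation.Binary.PropositionalEquality
  using (_≡_; _≢_; refl; sym; trans; cong; subst₂; ≢-sym; module ≡-Reasoning)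

allPairs-lookup : ∀ {a ℓ} {A : Set a} {R : Rel A ℓ} → Symmetric R →
                  ∀ {n} {v : Vec A n} → AllPairs R v →
                  ∀ i j → i ≢ j → R (lookup v i) (lookup v j)
allPairs-lookup R-sym (_   ∷ _)   zero    zero    i≢j = ⊥-elim (i≢j refl)
allPairs-lookup R-sym (Rv₀ ∷ _)   zero    (suc j) _   = lookup⁺ Rv₀ j
allPairs-lookup R-sym (Rv₀ ∷ _)   (suc i) zero    _   = R-sym (lookup⁺ Rv₀ i)
allPairs-lookup R-sym (_   ∷ Rvs) (suc i) (suc j) i≢j =
  allPairs-lookup R-sym Rvs i j (i≢j ∘ cong suc)

module _ (em : ExcludedMiddle) where

  dne : {P : Set} → ¬ ¬ P → P
  dne {P} ¬¬p with em P
  ... | inj₁ p  = p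
  ... | inj₂ ¬p = ⊥-elim (¬¬p ¬p)

  ¬∀⇒∃¬ : {A : Set} {P : A → Set} → ¬ (∀ a → P a) → ∃ λ a → ¬ P a
  ¬∀⇒∃¬ ¬∀P = dne λ ¬∃¬P → ¬∀P λ a → dne λ ¬Pa → ¬∃¬P (a , ¬Pa)

module _ (R : RealNumbers) where
  open RealNumbers R
  open IsCommutativeRing isCommutativeRing using (+-isGroup; +-comm; +-identityˡ)
  open IsTotalOrder isTotalOrder using (antisym)

  +-group : Group 0ℓ 0ℓ
  +-group = record { isGroup = +-isGroup }

  nonneg-+-zeroˡ : ∀ {a b} → 0# ≤ a → 0# ≤ b → a + b ≡ 0# → a ≡ 0#
  nonneg-+-zeroˡ {a} {b} 0≤a 0≤b a+b≡0 = antisym a≤0 0≤a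
    where
    a≤0 : a ≤ 0#
    a≤0 = subst₂ _≤_ (+-identityˡ a) (trans (+-comm b a) a+b≡0) (+-monoˡ-≤ a 0≤b)

-- The disjuncts of  Line a b c :  c lies behind a (order c a b), within [a b], or beyond b (order a b c).
pattern behind o = inj₁ o
pattern within o = inj₂ (inj₁ o)
pattern beyond o = inj₂ (inj₂ o)

module _ {R : RealNumbers} (𝒬 : Quasimetric R) where
  open RealNumbers R
  open Quasimetric 𝒬
  open IsCommutativeRing isCommutativeRing using (+-assoc; +-identityˡ; +-identityʳ)
  open GroupProperties (+-group R) using (identityˡ-unique; identityʳ-unique)
  open ≡-Reasoning

  private
    L : Q → Q → Q → Set
    L = Line 𝒬

    Same : (Q → Set) → (Q → Set) → Set
    Same = SameSet 𝒬

  Ordered : Q → Q → Q → Set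
  Ordered a b c = Between 𝒬 a c b

  round-trip-zero : ∀ {a b} → ρ a b + ρ b a ≡ 0# → a ≡ b
  round-trip-zero {a} {b} e = ρ-zero⇒eq a b (nonneg-+-zeroˡ R (ρ-nonneg a b) (ρ-nonneg b a) e)

  ordered-antisymˡ : ∀ {a b c} → Ordered a b c → Ordered b a c → a ≡ b
  ordered-antisymˡ {a} {b} {c} abc bac = round-trip-zero (identityˡ-unique _ (ρ a c) (sym (begin
    ρ a c                   ≡⟨ abc ⟩
    ρ a b + ρ b c           ≡⟨ cong (ρ a b +_) bac ⟩
    ρ a b + (ρ b a + ρ a c) ≡⟨ sym (+-assoc (ρ a b) (ρ b a) (ρ a c)) ⟩
    ρ a b + ρ b a + ρ a c   ∎)))

  ordered-antisymʳ : ∀ {a b c} → Ordered a b c → Ordered a c b → b ≡ c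
  ordered-antisymʳ {a} {b} {c} abc acb = round-trip-zero (identityʳ-unique (ρ a b) _ (sym (begin
    ρ a b                   ≡⟨ acb ⟩
    ρ a c + ρ c b           ≡⟨ cong (_+ ρ c b) abc ⟩
    ρ a b + ρ b c + ρ c b   ≡⟨ +-assoc (ρ a b) (ρ b c) (ρ c b) ⟩
    ρ a b + (ρ b c + ρ c b) ∎)))

  line-start : ∀ a b → L a b a
  line-start a b = behind (sym (trans (cong (_+ ρ a b) (eq⇒ρ-zero a)) (+-identityˡ (ρ a b))))

  line-end : ∀ a b → L a b b
  line-end a b = within (sym (trans (cong (ρ a b +_) (eq⇒ρ-zero b)) (+-identityʳ (ρ a b))))

  Collinear : Q → Q → Q → Set
  Collinear a b c = L a b c ⊎ L b a c

  collinear-swapˡ : ∀ {a b c} → Collinear a b c → Collinear b a c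
  collinear-swapˡ (inj₁ c∈ab) = inj₂ c∈ab
  collinear-swapˡ (inj₂ c∈ba) = inj₁ c∈ba

  collinear-swapʳ : ∀ {a b c} → Collinear a b c → Collinear a c b
  collinear-swapʳ (inj₁ (behind cab)) = inj₂ (beyond cab)
  collinear-swapʳ (inj₁ (within acb)) = inj₁ (beyond acb)
  collinear-swapʳ (inj₁ (beyond abc)) = inj₁ (within abc)
  collinear-swapʳ (inj₂ (behind cba)) = inj₂ (within cba)
  collinear-swapʳ (inj₂ (within bca)) = inj₂ (behind bca)
  collinear-swapʳ (inj₂ (beyond bac)) = inj₁ (behind bac)

  collinear-reverse : ∀ {a b c} → Collinear a b c → Collinear c b a
  collinear-reverse = collinear-swapˡ ∘ collinear-swapʳ ∘ collinear-swapˡ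

  OnBothLines : Q → Q → Q → Set
  OnBothLines a b c = L a b c × L b a c

  collinear⇒onBothLines : ∀ {a b c} → Same (L a b) (L b a) → Collinear a b c → OnBothLines a b c
  collinear⇒onBothLines ab≈ba (inj₁ c∈ab) = c∈ab , proj₁ (ab≈ba _) c∈ab
  collinear⇒onBothLines ab≈ba (inj₂ c∈ba) = proj₂ (ab≈ba _) c∈ba , c∈ba

  onBothLines-rotate : ∀ {a b c} → a ≢ b → OnBothLines a b c → ¬ L c b a → OnBothLines a c b
  onBothLines-rotate {a} {b} {c} a≢b (c∈ab , c∈ba) a∉cb = within abc , behind (ordered-bca c∈ba)
    where
    ordered-abc : L a b c → Ordered a b c
    ordered-abc (behind cab) = ⊥-elim (a∉cb (within cab))
    ordered-abc (within acb) = ⊥-elim (a∉cb (behind acb))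
    ordered-abc (beyond abc) = abc

    abc : Ordered a b c
    abc = ordered-abc c∈ab

    ordered-bca : L b a c → Ordered b c a
    ordered-bca (behind cba) = ⊥-elim (a∉cb (beyond cba))
    ordered-bca (within bca) = bca
    ordered-bca (beyond bac) = ⊥-elim (a≢b (ordered-antisymˡ abc bac))

  ≢-by : (A : Q → Set) → ∀ {p q} → A p → ¬ A q → p ≢ q
  ≢-by A Ap ¬Aq refl = ¬Aq Ap

  sameSet-sym : ∀ {A B} → Same A B → Same B A
  sameSet-sym A≈B z = proj₂ (A≈B z) , proj₁ (A≈B z)

  separate : ∀ {A B p} → A p → ¬ B p → ¬ Same A B
  separate Ap ¬Bp A≈B = ¬Bp (proj₁ (A≈B _) Ap)

  separate′ : ∀ {A B p} → ¬ A p → B p → ¬ Same A B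
  separate′ ¬Ap Bp A≈B = ¬Ap (proj₂ (A≈B _) Bp)

  ¬Same⇒witness : ExcludedMiddle → ∀ {A B} → ¬ Same A B →
                  (∃ λ z → A z × ¬ B z) ⊎ (∃ λ z → B z × ¬ A z)
  ¬Same⇒witness em {A} {B} A≉B with em (∃ λ z → A z × ¬ B z) | em (∃ λ z → B z × ¬ A z)
  ... | inj₁ A∖B | _        = inj₁ A∖B
  ... | inj₂ _   | inj₁ B∖A = inj₂ B∖A
  ... | inj₂ ∄A∖B | inj₂ ∄B∖A =
    ⊥-elim (A≉B λ z → (λ Az → dne em λ ¬Bz → ∄A∖B (z , Az , ¬Bz))
                    , (λ Bz → dne em λ ¬Az → ∄B∖A (z , Bz , ¬Az)))

  DistinctLines : Rel (Q × Q) 0ℓ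
  DistinctLines p q = ¬ Same (uncurry L p) (uncurry L q)

  atLeastFiveLines : (v : Vec (Q × Q) 5) → All (uncurry _≢_) v → AllPairs DistinctLines v →
                     AtLeastFiveLines 𝒬
  atLeastFiveLines v endpoints-distinct lines-distinct =
    (λ i → proj₁ (lookup v i)) , (λ i → proj₂ (lookup v i)) ,
    lookup⁺ endpoints-distinct ,
    allPairs-lookup (_∘ sameSet-sym) lines-distinct

  module _ {x y z : Q} (x≢y : x ≢ y) (xy≉yx : ¬ Same (L x y) (L y x)) (xyz : ¬ Collinear x y z) where

    private
      z∉xy : ¬ L x y z
      z∉xy = xyz ∘ inj₁

      z∉yx : ¬ L y x z
      z∉yx = xyz ∘ inj₂

      y∉xz : ¬ L x z y
      y∉xz = xyz ∘ collinear-swapʳ ∘ inj₁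

      y∉zx : ¬ L z x y
      y∉zx = xyz ∘ collinear-swapʳ ∘ inj₂

      x∉yz : ¬ L y z x
      x∉yz = xyz ∘ collinear-swapˡ ∘ collinear-swapʳ ∘ inj₁

      x≢z : x ≢ z
      x≢z = ≢-by (L x y) (line-start x y) z∉xy

      y≢z : y ≢ z
      y≢z = ≢-by (L x y) (line-end x y) z∉xy

    fiveLines-with : ∀ {a b} → a ≢ b →
                     ¬ Same (L x y) (L a b) → ¬ Same (L y x) (L a b) →
                     ¬ Same (L x z) (L a b) → ¬ Same (L y z) (L a b) → AtLeastFiveLines 𝒬
    fiveLines-with {a} {b} a≢b xy≉ab yx≉ab xz≉ab yz≉ab =
      atLeastFiveLines ((x , y) ∷ (y , x) ∷ (x , z) ∷ (y , z) ∷ (a , b) ∷ [])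
        (x≢y ∷ ≢-sym x≢y ∷ x≢z ∷ y≢z ∷ a≢b ∷ [])
        ( (xy≉yx ∷ separate′ z∉xy (line-end x z) ∷ separate′ z∉xy (line-end y z) ∷ xy≉ab ∷ [])
        ∷ (separate′ z∉yx (line-end x z) ∷ separate′ z∉yx (line-end y z) ∷ yx≉ab ∷ [])
        ∷ (separate′ y∉xz (line-start y z) ∷ xz≉ab ∷ [])
        ∷ (yz≉ab ∷ [])
        ∷ []
        ∷ [])

    fiveLines-through-xyz : ∀ {a b} → a ≢ b → L a b x → L a b y → L a b z → AtLeastFiveLines 𝒬
    fiveLines-through-xyz a≢b x∈ab y∈ab z∈ab = fiveLines-with a≢b
      (separate′ z∉xy z∈ab) (separate′ z∉yx z∈ab) (separate′ y∉xz y∈ab) (separate′ x∉yz x∈ab)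

    fiveLines-avoiding-yz : ∀ {a b} → a ≢ b → ¬ L a b y → ¬ L a b z → AtLeastFiveLines 𝒬
    fiveLines-avoiding-yz a≢b y∉ab z∉ab = fiveLines-with a≢b
      (separate (line-end x y) y∉ab) (separate (line-start y x) y∉ab)
      (separate (line-end x z) z∉ab) (separate (line-end y z) z∉ab)

    fiveLines-avoiding-xz : ∀ {a b} → a ≢ b → ¬ L a b x → ¬ L a b z → AtLeastFiveLines 𝒬
    fiveLines-avoiding-xz a≢b x∉ab z∉ab = fiveLines-with a≢b
      (separate (line-start x y) x∉ab) (separate (line-end y x) x∉ab)
      (separate (line-start x z) x∉ab) (separate (line-end y z) z∉ab)

    fiveLines-avoiding-xy : ∀ {a b} → a ≢ b → ¬ L a b x → ¬ L a b y → AtLeastFiveLines 𝒬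
    fiveLines-avoiding-xy a≢b x∉ab y∉ab = fiveLines-with a≢b
      (separate (line-start x y) x∉ab) (separate (line-end y x) x∉ab)
      (separate (line-start x z) x∉ab) (separate (line-start y z) y∉ab)

    fiveLines-zx : ¬ Same (L x z) (L z x) → AtLeastFiveLines 𝒬
    fiveLines-zx xz≉zx = fiveLines-with (≢-sym x≢z)
      (separate′ z∉xy (line-start z x)) (separate′ z∉yx (line-start z x))
      xz≉zx (separate (line-start y z) y∉zx)

    fiveLines-zy : ¬ Same (L y z) (L z y) → AtLeastFiveLines 𝒬
    fiveLines-zy yz≉zy = fiveLines-with (≢-sym y≢z)
      (separate′ z∉xy (line-start z y)) (separate′ z∉yx (line-start z y))
      (separate′ y∉xz (line-end z y)) yz≉zy

    module _ (em : ExcludedMiddle) (xz≈zx : Same (L x z) (L z x)) (yz≈zy : Same (L y z) (L z y))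
             {w : Q} (w∈xy : L x y w) (w∉yx : ¬ L y x w) where

      private
        x≢w : x ≢ w
        x≢w = ≢-by (L y x) (line-end y x) w∉yx

        y≢w : y ≢ w
        y≢w = ≢-by (L y x) (line-start y x) w∉yx

        w≢z : w ≢ z
        w≢z = ≢-by (L x y) w∈xy z∉xy

      fiveLines-cycle : Ordered w x y → Ordered x y w → AtLeastFiveLines 𝒬
      fiveLines-cycle wxy xyw with em (Collinear x w z) | em (Collinear y w z)
      ... | inj₁ (inj₁ z∈xw) | _ = fiveLines-through-xyz x≢w (line-start x w) (within xyw) z∈xw
      ... | inj₁ (inj₂ z∈wx) | _ = fiveLines-through-xyz (≢-sym x≢w) (line-end w x) (beyond wxy) z∈wx
      ... | inj₂ _ | inj₁ (inj₁ z∈yw) = fiveLines-through-xyz y≢w (behind xyw) (line-start y w) z∈yw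
      ... | inj₂ _ | inj₁ (inj₂ z∈wy) = fiveLines-through-xyz (≢-sym y≢w) (within wxy) (line-end w y) z∈wy
      ... | inj₂ xwz | inj₂ ywz =
        fiveLines-avoiding-xy (≢-sym w≢z) (xwz ∘ collinear-reverse ∘ inj₁) (ywz ∘ collinear-reverse ∘ inj₁)

      cycle-from-xw : L x w y → L w x y → Ordered w x y × Ordered x y w
      cycle-from-xw y∈xw y∈wx = wxy y∈wx , xyw y∈xw
        where
        wxy : L w x y → Ordered w x y
        wxy (behind ywx) = ⊥-elim (w∉yx (within ywx))
        wxy (within wyx) = ⊥-elim (w∉yx (behind wyx))
        wxy (beyond wxy) = wxy

        xyw : L x w y → Ordered x y w
        xyw (behind yxw) = ⊥-elim (w∉yx (beyond yxw))
        xyw (within xyw) = xyw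
        xyw (beyond xwy) = ⊥-elim (x≢w (ordered-antisymˡ xwy (wxy y∈wx)))

      cycle-from-yw : L y w x → L w y x → Ordered w x y × Ordered x y w
      cycle-from-yw x∈yw x∈wy = wxy x∈wy , xyw x∈yw
        where
        xyw : L y w x → Ordered x y w
        xyw (behind xyw) = xyw
        xyw (within yxw) = ⊥-elim (w∉yx (beyond yxw))
        xyw (beyond ywx) = ⊥-elim (w∉yx (within ywx))

        wxy : L w y x → Ordered w x y
        wxy (behind xwy) = ⊥-elim (y≢w (ordered-antisymʳ (xyw x∈yw) xwy))
        wxy (within wxy) = wxy
        wxy (beyond wyx) = ⊥-elim (w∉yx (behind wyx))

      fiveLines-¬xzw : ¬ Collinear x z w → AtLeastFiveLines 𝒬
      fiveLines-¬xzw xzw with em (L x w y) | em (L w x y)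
      ... | inj₂ y∉xw | _ = fiveLines-avoiding-yz x≢w y∉xw (xzw ∘ collinear-swapʳ ∘ inj₁)
      ... | inj₁ _ | inj₂ y∉wx = fiveLines-avoiding-yz (≢-sym x≢w) y∉wx (xzw ∘ collinear-swapʳ ∘ inj₂)
      ... | inj₁ y∈xw | inj₁ y∈wx = uncurry fiveLines-cycle (cycle-from-xw y∈xw y∈wx)

      fiveLines-¬yzw : ¬ Collinear y z w → AtLeastFiveLines 𝒬
      fiveLines-¬yzw yzw with em (L y w x) | em (L w y x)
      ... | inj₂ x∉yw | _ = fiveLines-avoiding-xz y≢w x∉yw (yzw ∘ collinear-swapʳ ∘ inj₁)
      ... | inj₁ _ | inj₂ x∉wy = fiveLines-avoiding-xz (≢-sym y≢w) x∉wy (yzw ∘ collinear-swapʳ ∘ inj₂)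
      ... | inj₁ x∈yw | inj₁ x∈wy = uncurry fiveLines-cycle (cycle-from-yw x∈yw x∈wy)

      fiveLines-x∉wz : Collinear x z w → ¬ L w z x → AtLeastFiveLines 𝒬
      fiveLines-x∉wz xzw x∉wz
        with collinear-swapʳ (inj₁ w∈xy) | onBothLines-rotate x≢z (collinear⇒onBothLines xz≈zx xzw) x∉wz
      ... | inj₁ y∈xw | z∈xw , _ = fiveLines-through-xyz x≢w (line-start x w) y∈xw z∈xw
      ... | inj₂ y∈wx | _ , z∈wx = fiveLines-through-xyz (≢-sym x≢w) (line-end w x) y∈wx z∈wx

      fiveLines-y∉wz : Collinear y z w → ¬ L w z y → AtLeastFiveLines 𝒬
      fiveLines-y∉wz yzw y∉wz
        with collinear-swapʳ (collinear-swapˡ (inj₁ w∈xy)) | onBothLines-rotate y≢z (collinear⇒onBothLines yz≈zy yzw) y∉wz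
      ... | inj₁ x∈yw | z∈yw , _ = fiveLines-through-xyz y≢w x∈yw (line-start y w) z∈yw
      ... | inj₂ x∈wy | _ , z∈wy = fiveLines-through-xyz (≢-sym y≢w) x∈wy (line-end w y) z∈wy

      fiveLines-witness : AtLeastFiveLines 𝒬
      fiveLines-witness with em (Collinear x z w) | em (Collinear y z w)
      ... | inj₂ xzw | _ = fiveLines-¬xzw xzw
      ... | inj₁ _ | inj₂ yzw = fiveLines-¬yzw yzw
      ... | inj₁ xzw | inj₁ yzw with em (L w z x) | em (L w z y)
      ...   | inj₂ x∉wz | _ = fiveLines-x∉wz xzw x∉wz
      ...   | inj₁ _ | inj₂ y∉wz = fiveLines-y∉wz yzw y∉wz
      ...   | inj₁ x∈wz | inj₁ y∈wz = fiveLines-through-xyz w≢z x∈wz y∈wz (line-end w z)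

  fiveLines-noncollinear : ExcludedMiddle → ∀ {x y z} → x ≢ y → ¬ Same (L x y) (L y x) →
                           ¬ Collinear x y z → AtLeastFiveLines 𝒬
  fiveLines-noncollinear em {x} {y} {z} x≢y xy≉yx xyz
    with em (Same (L x z) (L z x)) | em (Same (L y z) (L z y))
  ... | inj₂ xz≉zx | _ = fiveLines-zx x≢y xy≉yx xyz xz≉zx
  ... | inj₁ _ | inj₂ yz≉zy = fiveLines-zy x≢y xy≉yx xyz yz≉zy
  ... | inj₁ xz≈zx | inj₁ yz≈zy with ¬Same⇒witness em xy≉yx
  ...   | inj₁ (_ , w∈xy , w∉yx) = fiveLines-witness x≢y xy≉yx xyz em xz≈zx yz≈zy w∈xy w∉yx
  ...   | inj₂ (_ , w∈yx , w∉xy) = fiveLines-witness (≢-sym x≢y) (xy≉yx ∘ sameSet-sym)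
                                     (xyz ∘ collinear-swapˡ) em yz≈zy xz≈zx w∈yx w∉xy

mainTheorem3 : ExcludedMiddle → (R : RealNumbers) → (𝒬 : Quasimetric R) →
    (x y : Quasimetric.Q 𝒬) → x ≢ y →
    ¬ SameSet 𝒬 (Line 𝒬 x y) (Line 𝒬 y x) →
    ¬ (∀ z → Line 𝒬 x y z ⊎ Line 𝒬 y x z) →
    HasUniversalLine 𝒬 ⊎ AtLeastFiveLines 𝒬
mainTheorem3 em R 𝒬 x y x≢y xy≉yx xy∪yx≉Q =
  inj₂ (fiveLines-noncollinear 𝒬 em x≢y xy≉yx (proj₂ (¬∀⇒∃¬ em xy∪yx≉Q)))
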